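{- Let $c\ge 0$ and let $\pi=(d_1,\dots,d_n)$ be a $c$-cyclic degree sequence. Then there exist an extremal graph $G\in\Gamma(\pi)$ and a labeling $v_1,\dots,v_n$ of its vertices with $d(v_i)=d_i$ for all $i$ such that $\{v_2,v_3\}\subseteq N(v_1)$.
   Context: Graphs are finite, simple and connected; $N(v)$ is the neighbor set and $d(v)$ the degree of $v$. A connected graph with $n$ vertices and $n+c-1$ edges is called $c$-cyclic. A non-increasing sequence $\pi=(d_1,\dots,d_n)$ of positive integers is a $c$-cyclic degree sequence if it is the degree sequence of some connected $c$-cyclic graph; $\Gamma(\pi)$ is the set of connected graphs with degree sequence $\pi$. For a symmetric function $f(x,y)$ on pairs of positive reals, $M_f(G)=\sum_{uv\in E(G)}f(d(u),d(v))$. $f$ is escalating if $f(x_1,x_2)+f(y_1,y_2)\ge f(x_2,y_1)+f(x_1,y_2)$ for all $x_1\ge y_1>0$, $x_2\ge y_2>0$, strictly whenever $x_1>y_1$ and $x_2>y_2$; de-escalating if the reverse inequality holds for all such values, strictly whenever $x_1>y_1$ and $x_2>y_2$. A fixed escalating or de-escalating $f$ is given; $G$ is an extremal graph of a class $\mathcal G$ if either $f$ is escalating and $M_f(G)=\max_{H\in\mathcal G}M_f(H)$, or $f$ is de-escalating and $M_f(G)=\min_{H\in\mathcal G}M_f(H)$. -}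

module Defs where

open import Data.Nat using (ℕ; zero; suc; _+_; _≤_; _<_; _≤ᵇ_; _<ᵇ_)
open import Data.Bool using (Bool; true; false; if_then_else_; _∧_)
open import Data.Fin using (Fin; toℕ; _≟_)
open import Data.Nat.ListAction using (sum)
open import Data.List using (List; []; _∷_; allFin; map; concatMap; filter; foldr; length)
open import Data.Product using (Σ; ∃; _×_; _,_)
open import Data.Sum using (_⊎_)
open import Data.Fin.Permutation using (Permutation′; _⟨$⟩ʳ_)
open import Relation.Binary.PropositionalEquality using (_≡_; _≢_)
open import Relation.Nullary using (¬_)

-- Codomain of f: a totally ordered abelian group (e.g. the reals).

record OrderedAbGroup : Set₁ where
  infixl 6 _⊕_
  infix 4 _≼_
  field
    Carrier  : Set
    _⊕_      : Carrier → Carrier → Carrier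
    𝟘        : Carrier
    ⊖_       : Carrier → Carrier
    _≼_      : Carrier → Carrier → Set
    ⊕-assoc  : ∀ x y z → (x ⊕ y) ⊕ z ≡ x ⊕ (y ⊕ z)
    ⊕-comm   : ∀ x y → x ⊕ y ≡ y ⊕ x
    ⊕-idˡ    : ∀ x → 𝟘 ⊕ x ≡ x
    ⊕-invˡ   : ∀ x → (⊖ x) ⊕ x ≡ 𝟘
    ≼-refl   : ∀ x → x ≼ x
    ≼-trans  : ∀ {x y z} → x ≼ y → y ≼ z → x ≼ z
    ≼-antisym : ∀ {x y} → x ≼ y → y ≼ x → x ≡ y
    ≼-total  : ∀ x y → x ≼ y ⊎ y ≼ x
    ⊕-mono   : ∀ {x y} z → x ≼ y → x ⊕ z ≼ y ⊕ z

module _ (A : OrderedAbGroup) where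
  open OrderedAbGroup A

  infix 4 _≺_
  _≺_ : Carrier → Carrier → Set
  x ≺ y = x ≼ y × x ≢ y

  Symmetric : (ℕ → ℕ → Carrier) → Set
  Symmetric f = ∀ x y → 1 ≤ x → 1 ≤ y → f x y ≡ f y x

  -- escalating (evaluated on positive integers, the only values M_f uses)
  Escalating : (ℕ → ℕ → Carrier) → Set
  Escalating f =
    (∀ x₁ x₂ y₁ y₂ → 1 ≤ y₁ → 1 ≤ y₂ → y₁ ≤ x₁ → y₂ ≤ x₂ →
       f x₂ y₁ ⊕ f x₁ y₂ ≼ f x₁ x₂ ⊕ f y₁ y₂) ×
    (∀ x₁ x₂ y₁ y₂ → 1 ≤ y₁ → 1 ≤ y₂ → y₁ < x₁ → y₂ < x₂ →
       f x₂ y₁ ⊕ f x₁ y₂ ≺ f x₁ x₂ ⊕ f y₁ y₂)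

  DeEscalating : (ℕ → ℕ → Carrier) → Set
  DeEscalating f =
    (∀ x₁ x₂ y₁ y₂ → 1 ≤ y₁ → 1 ≤ y₂ → y₁ ≤ x₁ → y₂ ≤ x₂ →
       f x₁ x₂ ⊕ f y₁ y₂ ≼ f x₂ y₁ ⊕ f x₁ y₂) ×
    (∀ x₁ x₂ y₁ y₂ → 1 ≤ y₁ → 1 ≤ y₂ → y₁ < x₁ → y₂ < x₂ →
       f x₁ x₂ ⊕ f y₁ y₂ ≺ f x₂ y₁ ⊕ f x₁ y₂)

record Graph (n : ℕ) : Set where
  field
    adj     : Fin n → Fin n → Bool
    adj-sym : ∀ i j → adj i j ≡ adj j i
    adj-irr : ∀ i → adj i i ≡ false
open Graph public

data Walk {n : ℕ} (G : Graph n) : Fin n → Fin n → Set where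
  here : ∀ {u} → Walk G u u
  step : ∀ {u v w} → adj G u v ≡ true → Walk G v w → Walk G u w

Connected : ∀ {n} → Graph n → Set
Connected {n} G = ∀ (u v : Fin n) → Walk G u v

deg : ∀ {n} → Graph n → Fin n → ℕ
deg {n} G i = sum (map (λ j → if adj G i j then 1 else 0) (allFin n))

edges : ∀ {n} → Graph n → List (Fin n × Fin n)
edges {n} G =
  concatMap (λ i → concatMap (λ j →
      if adj G i j ∧ (toℕ i <ᵇ toℕ j) then (i , j) ∷ [] else [])
    (allFin n)) (allFin n)

edgeCount : ∀ {n} → Graph n → ℕ
edgeCount G = length (edges G)

-- G has degree sequence d (as a multiset): some labeling v_i = σ i has d(v_i) = d_i
HasDegSeq : ∀ {n} → Graph n → (Fin n → ℕ) → Set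
HasDegSeq {n} G d = Σ (Permutation′ n) λ σ → ∀ i → deg G (σ ⟨$⟩ʳ i) ≡ d i

InΓ : ∀ {n} → (Fin n → ℕ) → Graph n → Set
InΓ d G = Connected G × HasDegSeq G d

IsSeq : ∀ {n} → (Fin n → ℕ) → Set
IsSeq {n} d = (∀ i → 1 ≤ d i) × (∀ (i j : Fin n) → toℕ i ≤ toℕ j → d j ≤ d i)

CCyclicDegSeq : (c : ℕ) → ∀ {n} → (Fin n → ℕ) → Set
CCyclicDegSeq c {n} d =
  IsSeq d × ∃ λ (G : Graph n) → InΓ d G × edgeCount G + 1 ≡ n + c

module _ (A : OrderedAbGroup) where
  open OrderedAbGroup A

  M : (ℕ → ℕ → Carrier) → ∀ {n} → Graph n → Carrier
  M f G = foldr (λ e acc → f (deg G (Data.Product.proj₁ e)) (deg G (Data.Product.proj₂ e)) ⊕ acc) 𝟘 (edges G)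

  Extremal : (ℕ → ℕ → Carrier) → ∀ {n} → (Fin n → ℕ) → Graph n → Set
  Extremal f {n} d G =
    InΓ d G ×
    ((Escalating A f → ∀ (H : Graph n) → InΓ d H → M f H ≼ M f G) ×
     (DeEscalating A f → ∀ (H : Graph n) → InΓ d H → M f G ≼ M f H))

-- Γ(π) is finite, so some G ∈ Γ(π) optimises M_f (maximal if f is escalating, minimal if it is
-- de-escalating); label it so that d(vᵢ) = dᵢ and put z = v₁. If z is not adjacent to
-- t ∈ {v₂, v₃}, then t has the largest degree outside {z, e} for some neighbour e of z
-- (e = v₂ when t = v₃). A 2-switch replacing edges za, tb by zt, ab with a ≠ e preserves all
-- degrees and the edge ze, and since d(a) ≤ d(t) and d(b) ≤ d(z) it does not make M_f worse;
-- two such switches make z adjacent to v₂ and v₃.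
--
-- The switch is read off a shortest path z, p, s, …, x, y, t. If e = p, take b = y and
-- a ∈ N(z) ∖ {p} not adjacent to y; otherwise take a = p and b ∈ N(t) ∖ {y} not adjacent to p.
-- The part of the path from p to y survives the switch and reconnects the graph. If no such
-- vertex exists, then y is adjacent to N(z) ∖ {p} and to t and x, or p is adjacent to
-- N(t) ∖ {y} and to z and s; either way deg y > deg z or deg p > deg t, contradicting the choice
-- of z and t.

module Submission where

open import Defs
open import Algebra.Bundles using (CommutativeMonoid)
open import Algebra.Structures using (IsCommutativeMonoid)
open import Algebra.Structures.Biased using (isCommutativeMonoidˡ)
import Algebra.Properties.CommutativeMonoid.Sum as CommutativeMonoidSum
open import Data.Bool as Bool using (Bool; true; false; if_then_else_; _∧_; _∨_; T)
open import Data.Empty using (⊥-elim)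
open import Data.Fin using (Fin; zero; suc; toℕ; _≟_; punchIn)
import Data.Fin.Properties as Finₚ
open import Data.Fin.Properties using (any?; all?; ¬∀⟶∃¬; toℕ-injective)
open import Data.Fin.Permutation as Perm
  using (Permutation′; _⟨$⟩ʳ_; _⟨$⟩ˡ_; inverseʳ; inverseˡ; insert; remove; insert-remove; _≈_)
open import Data.List using (List; []; _∷_; _++_; foldr; map; tabulate; concatMap; allFin; filter)
import Data.List.Extrema as Extrema
open import Data.List.Membership.Propositional using (find)
open import Data.List.Membership.Propositional.Properties using (∈-filter⁺)
open import Data.List.Properties using (map-tabulate)
open import Data.List.Relation.Unary.All using (lookup)
open import Data.List.Relation.Unary.All.Properties using (all-filter)
open import Data.List.Relation.Unary.Any as Any using (Any; here)
open import Data.List.Relation.Unary.Any.Properties using (map⁺; concatMap⁺; tabulate⁺)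
open import Data.Nat as ℕ using (ℕ; zero; suc; _+_; _∸_; _≤_; _<_; z≤n; s≤s; _<ᵇ_)
import Data.Nat.ListAction as ListAction
open import Data.Nat.Properties hiding (_≟_)
open import Data.Nat.Tactic.RingSolver using (solve-∀)
open import Data.Product using (∃; ∃₂; Σ; _×_; _,_; proj₁; proj₂)
open import Data.Sum using (_⊎_; inj₁; inj₂; [_,_]′)
open import Data.Vec.Functional using () renaming (_∷_ to _∷ᶠ_)
open import Function.Base using (id; _∘_; const; flip)
open import Function.Bundles using (mk⇔)
open import Level using (0ℓ)
open import Relation.Binary.Bundles using (TotalOrder)
open import Relation.Binary.Definitions using (tri<; tri≈; tri>)
open import Relation.Binary.PropositionalEquality
open import Relation.Binary.Structures using (IsTotalOrder)
open import Relation.Nullary using (¬_; Dec; does; yes; no; ¬?)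
open import Relation.Nullary.Decidable using (_×-dec_; _⊎-dec_; _→-dec_; map′; does-⇔; dec-true; dec-false)
open import Relation.Unary using (Pred; Decidable; _⊆_; _∈_; _∉_; _≐_; _∪_; _∖_; _⊥_)
open import Relation.Unary.Properties using (_∪?_)

module GuardedSums {A : Set} {_∙_ : A → A → A} {ε : A} (isCM : IsCommutativeMonoid _≡_ _∙_ ε) where

  open IsCommutativeMonoid isCM using (identityˡ; identityʳ; comm; assoc)

  commutativeMonoid : CommutativeMonoid 0ℓ 0ℓ
  commutativeMonoid = record { isCommutativeMonoid = isCM }

  open CommutativeMonoidSum commutativeMonoid public
    using (sum; ∑-distrib-+; sum-cong-≗; sum-replicate-zero)
  open ≡-Reasoning

  infixr 8 _⊙_

  _⊙_ : Bool → A → A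
  b ⊙ x = if b then x else ε

  ⊙-∧ : ∀ a b x → (a ∧ b) ⊙ x ≡ a ⊙ b ⊙ x
  ⊙-∧ true  b x = refl
  ⊙-∧ false b x = refl

  ⊙-ε : ∀ b → b ⊙ ε ≡ ε
  ⊙-ε true  = refl
  ⊙-ε false = refl

  ⊙-∨ : ∀ a b x → ¬ (T a × T b) → (a ∨ b) ⊙ x ≡ (a ⊙ x) ∙ (b ⊙ x)
  ⊙-∨ true  true  x ab = ⊥-elim (ab (_ , _))
  ⊙-∨ true  false x _  = sym (identityʳ x)
  ⊙-∨ false b     x _  = sym (identityˡ (b ⊙ x))

  ∑-⊙ : ∀ {n} b (h : Fin n → A) → sum (λ j → b ⊙ h j) ≡ b ⊙ sum h
  ∑-⊙ true  h = refl
  ∑-⊙ {n} false h = sum-replicate-zero n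

  ∑-δ : ∀ {n} (y : Fin n) (h : Fin n → A) → sum (λ j → does (j ≟ y) ⊙ h j) ≡ h y
  ∑-δ {suc n} zero h = begin
    h zero ∙ sum (λ j → false ⊙ h (suc j))  ≡⟨ cong (h zero ∙_) (sum-replicate-zero n) ⟩
    h zero ∙ ε                              ≡⟨ identityʳ _ ⟩
    h zero                                  ∎
  ∑-δ {suc n} (suc y) h = begin
    ε ∙ sum (λ j → does (suc j ≟ suc y) ⊙ h (suc j))  ≡⟨ identityˡ _ ⟩
    sum (λ j → does (suc j ≟ suc y) ⊙ h (suc j))      ≡⟨ sum-cong-≗ shift ⟩
    sum (λ j → does (j ≟ y) ⊙ h (suc j))              ≡⟨ ∑-δ y (λ j → h (suc j)) ⟩
    h (suc y)                                         ∎
    where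
    shift : ∀ j → does (suc j ≟ suc y) ⊙ h (suc j) ≡ does (j ≟ y) ⊙ h (suc j)
    shift j with j ≟ y
    ... | yes _ = refl
    ... | no  _ = refl

  ∑-update : ∀ {n} (c g : Fin n → Bool) (β b : Bool) (w : Fin n → A) → (∀ j → T (c j) → g j ≡ β) →
    sum (λ j → (if c j then b else g j) ⊙ w j) ∙ (β ⊙ sum (λ j → c j ⊙ w j))
      ≡ sum (λ j → g j ⊙ w j) ∙ (b ⊙ sum (λ j → c j ⊙ w j))
  ∑-update {n} c g β b w c⇒g = begin
    sum (λ j → (if c j then b else g j) ⊙ w j) ∙ (β ⊙ sum (λ j → c j ⊙ w j))
      ≡⟨ cong (_ ∙_) (∑-⊙ {n} β _) ⟨
    sum (λ j → (if c j then b else g j) ⊙ w j) ∙ sum (λ j → β ⊙ c j ⊙ w j)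
      ≡⟨ ∑-distrib-+ {n} _ _ ⟨
    sum (λ j → ((if c j then b else g j) ⊙ w j) ∙ (β ⊙ c j ⊙ w j))
      ≡⟨ sum-cong-≗ (λ j → pointwise (c j) (g j) (w j) (c⇒g j)) ⟩
    sum (λ j → (g j ⊙ w j) ∙ (b ⊙ c j ⊙ w j))
      ≡⟨ ∑-distrib-+ {n} _ _ ⟩
    sum (λ j → g j ⊙ w j) ∙ sum (λ j → b ⊙ c j ⊙ w j)
      ≡⟨ cong (_ ∙_) (∑-⊙ {n} b _) ⟩
    sum (λ j → g j ⊙ w j) ∙ (b ⊙ sum (λ j → c j ⊙ w j)) ∎
    where
    pointwise : ∀ c g x → (T c → g ≡ β) →
      ((if c then b else g) ⊙ x) ∙ (β ⊙ c ⊙ x) ≡ (g ⊙ x) ∙ (b ⊙ c ⊙ x)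
    pointwise true  g x c⇒g rewrite c⇒g _ = comm (b ⊙ x) (β ⊙ x)
    pointwise false g x _   rewrite ⊙-ε β | ⊙-ε b = refl

  ∑-pair : ∀ {n} a b (x y : Fin n) (h : Fin n → A) → ¬ (T a × T b) →
    sum (λ j → ((a ∧ does (j ≟ y)) ∨ (b ∧ does (j ≟ x))) ⊙ h j) ≡ (a ⊙ h y) ∙ (b ⊙ h x)
  ∑-pair {n} a b x y h ¬ab = begin
    sum (λ j → ((a ∧ does (j ≟ y)) ∨ (b ∧ does (j ≟ x))) ⊙ h j)
      ≡⟨ sum-cong-≗ (λ j → ⊙-∨ (a ∧ _) (b ∧ _) (h j) λ (p , q) → ¬ab (T-∧ˡ a p , T-∧ˡ b q)) ⟩
    sum (λ j → ((a ∧ does (j ≟ y)) ⊙ h j) ∙ ((b ∧ does (j ≟ x)) ⊙ h j))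
      ≡⟨ ∑-distrib-+ {n} _ _ ⟩
    sum (λ j → (a ∧ does (j ≟ y)) ⊙ h j) ∙ sum (λ j → (b ∧ does (j ≟ x)) ⊙ h j)
      ≡⟨ cong₂ _∙_ (sum-cong-≗ (λ j → ⊙-∧ a _ (h j))) (sum-cong-≗ (λ j → ⊙-∧ b _ (h j))) ⟩
    sum (λ j → a ⊙ does (j ≟ y) ⊙ h j) ∙ sum (λ j → b ⊙ does (j ≟ x) ⊙ h j)
      ≡⟨ cong₂ _∙_ (∑-⊙ {n} a _) (∑-⊙ {n} b _) ⟩
    (a ⊙ sum (λ j → does (j ≟ y) ⊙ h j)) ∙ (b ⊙ sum (λ j → does (j ≟ x) ⊙ h j))
      ≡⟨ cong₂ _∙_ (cong (a ⊙_) (∑-δ y h)) (cong (b ⊙_) (∑-δ x h)) ⟩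
    (a ⊙ h y) ∙ (b ⊙ h x) ∎
    where
    T-∧ˡ : ∀ a {c} → T (a ∧ c) → T a
    T-∧ˡ true _ = _

  foldr-tabulate : ∀ {n} (h : Fin n → A) → foldr _∙_ ε (tabulate h) ≡ sum h
  foldr-tabulate {zero}  h = refl
  foldr-tabulate {suc n} h = cong (h zero ∙_) (foldr-tabulate (λ j → h (suc j)))

  listSum : ∀ {X : Set} → (X → A) → List X → A
  listSum w = foldr (λ x acc → w x ∙ acc) ε

  listSum-++ : ∀ {X : Set} (w : X → A) xs ys → listSum w (xs ++ ys) ≡ listSum w xs ∙ listSum w ys
  listSum-++ w []       ys = sym (identityˡ _)
  listSum-++ w (x ∷ xs) ys = trans (cong (w x ∙_) (listSum-++ w xs ys)) (sym (assoc _ _ _))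

  listSum-concatMap : ∀ {X Y : Set} {n} (w : Y → A) (g : X → List Y) (k : Fin n → X) →
    listSum w (concatMap g (tabulate k)) ≡ sum (λ i → listSum w (g (k i)))
  listSum-concatMap {n = zero}  w g k = refl
  listSum-concatMap {n = suc n} w g k = trans (listSum-++ w (g (k zero)) _)
    (cong (listSum w (g (k zero)) ∙_) (listSum-concatMap w g (λ i → k (suc i))))

  listSum-if : ∀ {X : Set} (w : X → A) b x → listSum w (if b then x ∷ [] else []) ≡ b ⊙ w x
  listSum-if w true  x = identityʳ (w x)
  listSum-if w false x = refl

module ℕ-Sums = GuardedSums +-0-isCommutativeMonoid
open ℕ-Sums using () renaming (sum to ∑; _⊙_ to _⊙ℕ_)
open ℕ-Sums using (foldr-tabulate) renaming (sum-cong-≗ to ∑-cong)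

true≢false : true ≢ false
true≢false ()

𝟙 : Bool → ℕ
𝟙 b = b ⊙ℕ 1

∑-mono-≤ : ∀ {n} {g h : Fin n → ℕ} → (∀ j → g j ≤ h j) → ∑ g ≤ ∑ h
∑-mono-≤ {zero}  _  = z≤n
∑-mono-≤ {suc n} le = +-mono-≤ (le zero) (∑-mono-≤ (λ j → le (suc j)))

∑-mono-< : ∀ {n} {g h : Fin n → ℕ} → (∀ j → g j ≤ h j) → ∀ x → g x < h x → ∑ g < ∑ h
∑-mono-< le zero    lt = +-mono-<-≤ lt (∑-mono-≤ (λ j → le (suc j)))
∑-mono-< le (suc x) lt = +-mono-≤-< (le zero) (∑-mono-< (λ j → le (suc j)) x lt)

∣_∣ : ∀ {n ℓ} {P : Pred (Fin n) ℓ} → Decidable P → ℕ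
∣ P? ∣ = ∑ λ j → 𝟙 (does (P? j))

module _ {n : ℕ} {ℓ₁ ℓ₂} {P : Pred (Fin n) ℓ₁} {Q : Pred (Fin n) ℓ₂}
         (P? : Decidable P) (Q? : Decidable Q) where

  private
    𝟙-mono : P ⊆ Q → ∀ j → 𝟙 (does (P? j)) ≤ 𝟙 (does (Q? j))
    𝟙-mono P⊆Q j with P? j | Q? j
    ... | no _  | _      = z≤n
    ... | yes _ | yes _  = ≤-refl
    ... | yes p | no ¬q  = ⊥-elim (¬q (P⊆Q p))

  P⊆Q⇒∣P∣≤∣Q∣ : P ⊆ Q → ∣ P? ∣ ≤ ∣ Q? ∣
  P⊆Q⇒∣P∣≤∣Q∣ P⊆Q = ∑-mono-≤ (𝟙-mono P⊆Q)

  P⊂Q⇒∣P∣<∣Q∣ : P ⊆ Q → ∀ {x} → x ∈ Q → x ∉ P → ∣ P? ∣ < ∣ Q? ∣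
  P⊂Q⇒∣P∣<∣Q∣ P⊆Q {x} x∈Q x∉P = ∑-mono-< (𝟙-mono P⊆Q) x (strict (P? x) (Q? x))
    where
    strict : (p : Dec (P x)) (q : Dec (Q x)) → 𝟙 (does p) < 𝟙 (does q)
    strict (yes p) _       = ⊥-elim (x∉P p)
    strict (no _)  (yes _) = s≤s z≤n
    strict (no _)  (no ¬q) = ⊥-elim (¬q x∈Q)

  P≐Q⇒∣P∣≡∣Q∣ : P ≐ Q → ∣ P? ∣ ≡ ∣ Q? ∣
  P≐Q⇒∣P∣≡∣Q∣ (P⊆Q , Q⊆P) = ∑-cong λ j → cong 𝟙 (does-⇔ (mk⇔ P⊆Q Q⊆P) (P? j) (Q? j))

  ∣P∪Q∣≡∣P∣+∣Q∣ : P ⊥ Q → ∣ P? ∪? Q? ∣ ≡ ∣ P? ∣ + ∣ Q? ∣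
  ∣P∪Q∣≡∣P∣+∣Q∣ P⊥Q = trans (∑-cong λ j → pointwise (P? j) (Q? j)) (ℕ-Sums.∑-distrib-+ {n} _ _)
    where
    pointwise : ∀ {j} (p : Dec (P j)) (q : Dec (Q j)) → 𝟙 (does (p ⊎-dec q)) ≡ 𝟙 (does p) + 𝟙 (does q)
    pointwise (yes p) (yes q) = ⊥-elim (P⊥Q (p , q))
    pointwise (yes _) (no _)  = refl
    pointwise (no _)  (yes _) = refl
    pointwise (no _)  (no _)  = refl

∣P∣≤n : ∀ {n ℓ} {P : Pred (Fin n) ℓ} (P? : Decidable P) → ∣ P? ∣ ≤ n
∣P∣≤n {zero}  P? = z≤n
∣P∣≤n {suc n} P? = +-mono-≤ (bounded (does (P? zero))) (∣P∣≤n (λ j → P? (suc j)))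
  where
  bounded : ∀ b → 𝟙 b ≤ 1
  bounded true  = ≤-refl
  bounded false = z≤n

∣≡x∣≡1 : ∀ {n} (x : Fin n) → ∣ _≟ x ∣ ≡ 1
∣≡x∣≡1 x = ℕ-Sums.∑-δ x (λ _ → 1)

∣P∣≡1+∣P∖x∣ : ∀ {n ℓ} {P : Pred (Fin n) ℓ} (P? : Decidable P) {x} → x ∈ P →
  ∣ P? ∣ ≡ suc ∣ (λ j → P? j ×-dec ¬? (j ≟ x)) ∣
∣P∣≡1+∣P∖x∣ {P = P} P? {x} x∈P = begin
  ∣ P? ∣                ≡⟨ P≐Q⇒∣P∣≡∣Q∣ P? (P∖x? ∪? (_≟ x)) (split , join) ⟩
  ∣ P∖x? ∪? (_≟ x) ∣    ≡⟨ ∣P∪Q∣≡∣P∣+∣Q∣ P∖x? (_≟ x) (λ ((_ , j≢x) , j≡x) → j≢x j≡x) ⟩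
  ∣ P∖x? ∣ + ∣ _≟ x ∣   ≡⟨ cong (∣ P∖x? ∣ +_) (∣≡x∣≡1 x) ⟩
  ∣ P∖x? ∣ + 1          ≡⟨ +-comm _ 1 ⟩
  suc ∣ P∖x? ∣          ∎
  where
  open ≡-Reasoning
  P∖x? = λ j → P? j ×-dec ¬? (j ≟ x)
  split : P ⊆ (P ∖ (_≡ x)) ∪ (_≡ x)
  split {j} j∈P with j ≟ x
  ... | yes j≡x = inj₂ j≡x
  ... | no  j≢x = inj₁ (j∈P , j≢x)
  join : (P ∖ (_≡ x)) ∪ (_≡ x) ⊆ P
  join (inj₁ (j∈P , _)) = j∈P
  join (inj₂ refl)      = x∈P

Nbr : ∀ {n} → Graph n → Fin n → Pred (Fin n) 0ℓ
Nbr G v j = adj G v j ≡ true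

nbr? : ∀ {n} (G : Graph n) v → Decidable (Nbr G v)
nbr? G v j = adj G v j Bool.≟ true

deg≡∑ : ∀ {n} (G : Graph n) v → deg G v ≡ ∑ (λ j → 𝟙 (adj G v j))
deg≡∑ {n} G v = trans (cong ListAction.sum (map-tabulate {n = n} id _)) (foldr-tabulate {n} _)

deg≡∣Nbr∣ : ∀ {n} (G : Graph n) v → deg G v ≡ ∣ nbr? G v ∣
deg≡∣Nbr∣ {n} G v = trans (deg≡∑ G v) (∑-cong (λ j → pointwise (adj G v j)))
  where
  pointwise : ∀ b → 𝟙 b ≡ 𝟙 (does (b Bool.≟ true))
  pointwise true  = refl
  pointwise false = refl

module _ {n} (G : Graph n) where

  adj-sym′ : ∀ {u v} → adj G u v ≡ true → adj G v u ≡ true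
  adj-sym′ {u} {v} uv = trans (adj-sym G v u) uv

  adj⇒≢ : ∀ {u v} → adj G u v ≡ true → u ≢ v
  adj⇒≢ {u} uv refl with trans (sym uv) (adj-irr G u)
  ... | ()

  deg-<-by-cover : ∀ {u v w a b} → adj G v u ≡ true →
    (∀ j → adj G v j ≡ true → j ≢ u → adj G w j ≡ true) → adj G w a ≡ true → adj G w b ≡ true →
    (adj G v a ≡ true → a ≡ u) → (adj G v b ≡ true → b ≡ u) → a ≢ b → deg G v < deg G w
  deg-<-by-cover {u} {v} {w} {a} {b} vu cover wa wb a∉ b∉ a≢b = begin-strict
    deg G v                ≡⟨ trans (deg≡∣Nbr∣ G v) (∣P∣≡1+∣P∖x∣ (nbr? G v) vu) ⟩
    suc ∣ N∖u? ∣           <⟨ ≤-reflexive (sym (trans (+-assoc _ 1 1) (+-comm _ 2))) ⟩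
    ∣ N∖u? ∣ + 1 + 1       ≡⟨ count ⟨
    ∣ N∖u+a+b? ∣           ≤⟨ P⊆Q⇒∣P∣≤∣Q∣ N∖u+a+b? (nbr? G w) covered ⟩
    ∣ nbr? G w ∣           ≡⟨ deg≡∣Nbr∣ G w ⟨
    deg G w                ∎
    where
    open ≤-Reasoning
    N∖u? = λ j → nbr? G v j ×-dec ¬? (j ≟ u)
    N∖u+a? = N∖u? ∪? (_≟ a)
    N∖u+a+b? = N∖u+a? ∪? (_≟ b)
    disjointᵃ : (Nbr G v ∖ (_≡ u)) ⊥ (_≡ a)
    disjointᵃ ((va , a≢u) , refl) = a≢u (a∉ va)
    disjointᵇ : ((Nbr G v ∖ (_≡ u)) ∪ (_≡ a)) ⊥ (_≡ b)
    disjointᵇ (inj₁ (vb , b≢u) , refl) = b≢u (b∉ vb)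
    disjointᵇ (inj₂ refl , refl)       = a≢b refl
    count : ∣ N∖u+a+b? ∣ ≡ ∣ N∖u? ∣ + 1 + 1
    count = trans (∣P∪Q∣≡∣P∣+∣Q∣ N∖u+a? (_≟ b) disjointᵇ) (cong₂ _+_
      (trans (∣P∪Q∣≡∣P∣+∣Q∣ N∖u? (_≟ a) disjointᵃ) (cong (∣ N∖u? ∣ +_) (∣≡x∣≡1 a)))
      (∣≡x∣≡1 b))
    covered : ((Nbr G v ∖ (_≡ u)) ∪ (_≡ a)) ∪ (_≡ b) ⊆ Nbr G w
    covered (inj₁ (inj₁ (vj , j≢u))) = cover _ vj j≢u
    covered (inj₁ (inj₂ refl))       = wa
    covered (inj₂ refl)              = wb

infixr 5 _++ʷ_

_++ʷ_ : ∀ {n} {G : Graph n} {u v w} → Walk G u v → Walk G v w → Walk G u w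
here      ++ʷ q = q
step uv p ++ʷ q = step uv (p ++ʷ q)

reverseʷ : ∀ {n} {G : Graph n} {u v} → Walk G u v → Walk G v u
reverseʷ {G = G} here        = here
reverseʷ {G = G} (step uv p) = reverseʷ p ++ʷ step (adj-sym′ G uv) here

least : ∀ {p} {P : Pred ℕ p} → Decidable P → ∀ {k} → P k → ∃ λ m → P m × (∀ {j} → P j → m ≤ j)
least {P = P} P? {k} Pk = [ id , (λ none → ⊥-elim (none ≤-refl Pk)) ]′ (search k)
  where
  search : ∀ k → (∃ λ m → P m × (∀ {j} → P j → m ≤ j)) ⊎ (∀ {j} → j ≤ k → ¬ P j)
  search zero with P? zero
  ... | yes P0 = inj₁ (zero , P0 , λ _ → z≤n)
  ... | no ¬P0 = inj₂ λ { z≤n → ¬P0 }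
  search (suc k) with search k
  ... | inj₁ found = inj₁ found
  ... | inj₂ none with P? (suc k)
  ...   | yes P1+k = inj₁ (suc k , P1+k , λ Pj → ≰⇒> (λ j≤k → none j≤k Pj))
  ...   | no ¬P1+k = inj₂ none′
    where
    none′ : ∀ {j} → j ≤ suc k → ¬ P j
    none′ j≤1+k with m≤n⇒m<n∨m≡n j≤1+k
    ... | inj₁ j<1+k = none (≤-pred j<1+k)
    ... | inj₂ refl  = ¬P1+k

Reach : ∀ {n} → Graph n → Fin n → ℕ → Fin n → Set
Reach G s zero    v = v ≡ s
Reach G s (suc k) v = Reach G s k v ⊎ ∃ λ w → Reach G s k w × adj G w v ≡ true

module _ {n} (G : Graph n) where

  reach? : ∀ s k → Decidable (Reach G s k)
  reach? s zero    v = v ≟ s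
  reach? s (suc k) v = reach? s k v ⊎-dec any? (λ w → reach? s k w ×-dec (adj G w v Bool.≟ true))

  reach⇒walk : ∀ {s} k {v} → Reach G s k v → Walk G s v
  reach⇒walk zero    refl                = here
  reach⇒walk (suc k) (inj₁ r)            = reach⇒walk k r
  reach⇒walk (suc k) (inj₂ (w , r , wv)) = reach⇒walk k r ++ʷ step wv here

  reach-prepend : ∀ {s u} → adj G s u ≡ true → ∀ k {v} → Reach G u k v → Reach G s (suc k) v
  reach-prepend {s} su zero    refl                = inj₂ (s , refl , su)
  reach-prepend     su (suc k) (inj₁ r)            = inj₁ (reach-prepend su k r)
  reach-prepend     su (suc k) (inj₂ (w , r , wv)) = inj₂ (w , reach-prepend su k r , wv)

  walk⇒reach : ∀ {s v} → Walk G s v → ∃ λ k → Reach G s k v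
  walk⇒reach here         = zero , refl
  walk⇒reach (step su p) with walk⇒reach p
  ... | k , r = suc k , reach-prepend su k r

  reach-mono : ∀ {s k m v} → k ≤ m → Reach G s k v → Reach G s m v
  reach-mono {m = zero}  z≤n r = r
  reach-mono {m = suc m} k≤1+m r with m≤n⇒m<n∨m≡n k≤1+m
  ... | inj₁ k<1+m = inj₁ (reach-mono (≤-pred k<1+m) r)
  ... | inj₂ refl  = r

  module _ (s : Fin n) where

    Stable : ℕ → Set
    Stable k = ∀ {v} → Reach G s (suc k) v → Reach G s k v

    stable⇒closed : ∀ {j} → Stable j → ∀ {m v} → j ≤ m → Reach G s m v → Reach G s j v
    stable⇒closed {j} st {zero}  z≤n r = r
    stable⇒closed {j} st {suc m} j≤1+m r with m≤n⇒m<n∨m≡n j≤1+m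
    ... | inj₂ refl  = r
    ... | inj₁ j<1+m with r
    ...   | inj₁ r′            = stable⇒closed st (≤-pred j<1+m) r′
    ...   | inj₂ (w , r′ , wv) = st (inj₂ (w , stable⇒closed st (≤-pred j<1+m) r′ , wv))

    -- A layer that is not stable reaches a new vertex, so some layer within n steps is stable.
    stabilises : ∀ k → (∃ λ j → j ≤ k × Stable j) ⊎ k < ∣ reach? s k ∣
    stabilises zero = inj₂ (≤-reflexive (sym (∣≡x∣≡1 s)))
    stabilises (suc k) with stabilises k
    ... | inj₁ (j , j≤k , st) = inj₁ (j , m≤n⇒m≤1+n j≤k , st)
    ... | inj₂ k<∣Rₖ∣ with all? (λ v → reach? s (suc k) v →-dec reach? s k v)
    ...   | yes st = inj₁ (k , n≤1+n k , λ {v} → st v)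
    ...   | no ¬st with ¬∀⟶∃¬ n _ (λ v → reach? s (suc k) v →-dec reach? s k v) ¬st
    ...     | v , new = inj₂ (≤-<-trans k<∣Rₖ∣ (P⊂Q⇒∣P∣<∣Q∣ (reach? s k) (reach? s (suc k)) inj₁
                (reached (reach? s (suc k) v)) (new ∘ const)))
      where
      reached : Dec (Reach G s (suc k) v) → Reach G s (suc k) v
      reached (yes r) = r
      reached (no ¬r) = ⊥-elim (new (⊥-elim ∘ ¬r))

    reach-bounded : ∀ {k v} → Reach G s k v → Reach G s n v
    reach-bounded {k} r with stabilises n
    ... | inj₂ n<∣Rₙ∣ = ⊥-elim (<⇒≱ n<∣Rₙ∣ (∣P∣≤n (reach? s n)))
    ... | inj₁ (j , j≤n , st) with ≤-total k j
    ...   | inj₁ k≤j = reach-mono (≤-trans k≤j j≤n) r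
    ...   | inj₂ j≤k = reach-mono j≤n (stable⇒closed st j≤k r)

  connected? : Dec (Connected G)
  connected? = map′ (λ h u v → reach⇒walk n (h u v))
    (λ c u v → reach-bounded u (proj₂ (walk⇒reach (c u v))))
    (all? λ u → all? λ v → reach? u n v)

module Distance {n} (G : Graph n) (z : Fin n) (conn : Connected G) where

  abstract

    private
      shortest : ∀ v → ∃ λ k → Reach G z k v × (∀ {j} → Reach G z j v → k ≤ j)
      shortest v = least (λ k → reach? G z k v) (proj₂ (walk⇒reach G (conn z v)))

    dist : Fin n → ℕ
    dist v = proj₁ (shortest v)

    dist-reach : ∀ v → Reach G z (dist v) v
    dist-reach v = proj₁ (proj₂ (shortest v))

    dist-min : ∀ v {j} → Reach G z j v → dist v ≤ j
    dist-min v = proj₂ (proj₂ (shortest v))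

  dist-z : dist z ≡ 0
  dist-z = n≤0⇒n≡0 (dist-min z refl)

  dist≡0 : ∀ {v} → dist v ≡ 0 → v ≡ z
  dist≡0 {v} d≡0 = subst (λ k → Reach G z k v) d≡0 (dist-reach v)

  dist-adj : ∀ {u v} → adj G u v ≡ true → dist v ≤ suc (dist u)
  dist-adj {u} {v} uv = dist-min v (inj₂ (u , dist-reach u , uv))

  dist-pred : ∀ v {k} → dist v ≡ suc k → ∃ λ w → adj G w v ≡ true × dist w ≡ k
  dist-pred v {k} d≡1+k with subst (λ j → Reach G z j v) d≡1+k (dist-reach v)
  ... | inj₁ r = ⊥-elim (<⇒≱ (≤-reflexive (sym d≡1+k)) (dist-min v r))
  ... | inj₂ (w , r , wv) = w , wv , ≤-antisym (dist-min w r)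
    (≤-pred (subst (_≤ suc (dist w)) d≡1+k (dist-adj wv)))

  abstract

    private
      parent-spec : ∀ v → ∃ λ w → dist w ≡ ℕ.pred (dist v) × (dist v ≢ 0 → adj G w v ≡ true)
      parent-spec v with dist v in d≡
      ... | zero  = v , d≡ , λ d≢0 → ⊥-elim (d≢0 refl)
      ... | suc k with dist-pred v d≡
      ...   | w , wv , dw = w , dw , λ _ → wv

    parent : Fin n → Fin n
    parent v = proj₁ (parent-spec v)

    dist-parent : ∀ v → dist (parent v) ≡ ℕ.pred (dist v)
    dist-parent v = proj₁ (proj₂ (parent-spec v))

    adj-parent : ∀ v → dist v ≢ 0 → adj G (parent v) v ≡ true
    adj-parent v = proj₂ (proj₂ (parent-spec v))

  ancestor : ℕ → Fin n → Fin n
  ancestor zero    v = v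
  ancestor (suc i) v = parent (ancestor i v)

  ancestor-suc : ∀ i v → ancestor (suc i) v ≡ ancestor i (parent v)
  ancestor-suc zero    v = refl
  ancestor-suc (suc i) v = cong parent (ancestor-suc i v)

  dist-ancestor : ∀ i v → dist (ancestor i v) ≡ dist v ∸ i
  dist-ancestor zero    v = refl
  dist-ancestor (suc i) v = trans (dist-parent (ancestor i v))
    (trans (cong ℕ.pred (dist-ancestor i v)) (pred[m∸n]≡m∸[1+n] (dist v) i))

  adj-ancestor : ∀ {i v} → i < dist v → adj G (ancestor (suc i) v) (ancestor i v) ≡ true
  adj-ancestor {i} {v} i<d = adj-parent (ancestor i v)
    λ d≡0 → <⇒≢ (m<n⇒0<n∸m i<d) (trans (sym d≡0) (dist-ancestor i v))

  ancestor-walk : ∀ {H : Graph n} j v → (∀ i → i < j → adj H (ancestor (suc i) v) (ancestor i v) ≡ true) →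
    Walk H (ancestor j v) v
  ancestor-walk zero    v edges = here
  ancestor-walk (suc j) v edges =
    step (edges j ≤-refl) (ancestor-walk j v (λ i i<j → edges i (m≤n⇒m≤1+n i<j)))

  adj-root⇒dist≡1 : ∀ {v} → adj G z v ≡ true → dist v ≡ 1
  adj-root⇒dist≡1 {v} z∼v = ≤-antisym (subst (λ d → dist v ≤ suc d) dist-z (dist-adj z∼v))
    (n≢0⇒n>0 λ d≡0 → adj⇒≢ G z∼v (sym (dist≡0 d≡0)))

  dist≡1⇒adj-root : ∀ {v} → dist v ≡ 1 → adj G z v ≡ true
  dist≡1⇒adj-root {v} d≡1 =
    subst (λ w → adj G w v ≡ true) parent≡z (adj-ancestor {0} (≤-reflexive (sym d≡1)))
    where
    parent≡z : parent v ≡ z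
    parent≡z = dist≡0 (trans (dist-ancestor 1 v) (cong (_∸ 1) d≡1))

  ancestor-adj-root : ∀ i v → adj G z (ancestor i v) ≡ true → i ≡ dist v ∸ 1
  ancestor-adj-root i v z∼a =
    ∸-cancelˡ-≡ (<⇒≤ i<d) (m∸n≤m (dist v) 1) (trans d∸i≡1 (sym (m∸[m∸n]≡n 1≤d)))
    where
    d∸i≡1 : dist v ∸ i ≡ 1
    d∸i≡1 = trans (sym (dist-ancestor i v)) (adj-root⇒dist≡1 z∼a)
    i<d : i < dist v
    i<d = m∸n≢0⇒n<m (λ d∸i≡0 → 1≢0 (trans (sym d∸i≡1) d∸i≡0))
      where
      1≢0 : 1 ≢ 0
      1≢0 ()
    1≤d : 1 ≤ dist v
    1≤d = ≤-trans (s≤s z≤n) i<d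

  ancestor-adj-self : ∀ {i v} → i ≤ dist v → adj G v (ancestor i v) ≡ true → i ≡ 1
  ancestor-adj-self {zero}  {v} _   v∼v = ⊥-elim (adj⇒≢ G v∼v refl)
  ancestor-adj-self {suc i} {v} i<d v∼a =
    cong suc (n≤0⇒n≡0 (≤-pred (+-cancelˡ-≤ (dist v ∸ suc i) (suc i) 1 bound)))
    where
    bound : dist v ∸ suc i + suc i ≤ dist v ∸ suc i + 1
    bound = begin
      dist v ∸ suc i + suc i          ≡⟨ m∸n+n≡m i<d ⟩
      dist v                          ≤⟨ dist-adj (adj-sym′ G v∼a) ⟩
      suc (dist (ancestor (suc i) v)) ≡⟨ cong suc (dist-ancestor (suc i) v) ⟩
      suc (dist v ∸ suc i)            ≡⟨ +-comm 1 _ ⟩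
      dist v ∸ suc i + 1              ∎
      where open ≤-Reasoning

T-does : ∀ {p} {P : Set p} (P? : Dec P) → T (does P?) → P
T-does (yes p) _ = p

<ᵇ-true : ∀ {m n} → (m <ᵇ n) ≡ true → m < n
<ᵇ-true {m} {n} m<n = <ᵇ⇒< m n (subst T (sym m<n) _)

<ᵇ-false : ∀ {m n} → (m <ᵇ n) ≡ false → ¬ m < n
<ᵇ-false m≮n m<n = subst T m≮n (<⇒<ᵇ m<n)

SamePair : ∀ {n} → Fin n → Fin n → Fin n → Fin n → Set
SamePair x y i j = (i ≡ x × j ≡ y) ⊎ (i ≡ y × j ≡ x)

samePair? : ∀ {n} (x y i j : Fin n) → Dec (SamePair x y i j)
samePair? x y i j = ((i ≟ x) ×-dec (j ≟ y)) ⊎-dec ((i ≟ y) ×-dec (j ≟ x))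

samePair-sym : ∀ {n} {x y i j : Fin n} → SamePair x y i j → SamePair x y j i
samePair-sym (inj₁ (i≡x , j≡y)) = inj₂ (j≡y , i≡x)
samePair-sym (inj₂ (i≡y , j≡x)) = inj₁ (j≡x , i≡y)

samePair⇒≡ : ∀ {n} {x y i : Fin n} → SamePair x y i i → x ≡ y
samePair⇒≡ (inj₁ (i≡x , i≡y)) = trans (sym i≡x) i≡y
samePair⇒≡ (inj₂ (i≡y , i≡x)) = trans (sym i≡x) i≡y

setEdge : ∀ {n} (x y : Fin n) → x ≢ y → Bool → Graph n → Graph n
setEdge x y x≢y b G = record
  { adj     = λ i j → if does (samePair? x y i j) then b else adj G i j
  ; adj-sym = λ i j → cong₂ (if_then b else_)
      (does-⇔ (mk⇔ samePair-sym samePair-sym) (samePair? x y i j) (samePair? x y j i)) (adj-sym G i j)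
  ; adj-irr = λ i → trans (cong (if_then b else adj G i i)
      (dec-false (samePair? x y i i) (x≢y ∘ samePair⇒≡))) (adj-irr G i)
  }

ends : ∀ {n} → Fin n → Fin n → Fin n → ℕ
ends x y v = 𝟙 (does (v ≟ x)) + 𝟙 (does (v ≟ y))

module _ {n} (G : Graph n) {x y : Fin n} (x≢y : x ≢ y) where

  setEdge-≢ : ∀ b i j → ¬ SamePair x y i j → adj (setEdge x y x≢y b G) i j ≡ adj G i j
  setEdge-≢ b i j ¬xy rewrite dec-false (samePair? x y i j) ¬xy = refl

  setEdge-≡ : ∀ b → adj (setEdge x y x≢y b G) x y ≡ b
  setEdge-≡ b rewrite dec-true (samePair? x y x y) (inj₁ (refl , refl)) = refl

  setEdge-keeps : ∀ b i j → adj G i j ≡ b → adj (setEdge x y x≢y b G) i j ≡ b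
  setEdge-keeps b i j ij with does (samePair? x y i j)
  ... | true  = refl
  ... | false = ij

  adj-samePair : ∀ {i j} → T (does (samePair? x y i j)) → adj G i j ≡ adj G x y
  adj-samePair {i} {j} xy with T-does (samePair? x y i j) xy
  ... | inj₁ (refl , refl) = refl
  ... | inj₂ (refl , refl) = adj-sym G y x

  deg-setEdge : ∀ b v →
    deg (setEdge x y x≢y b G) v + adj G x y ⊙ℕ ends x y v ≡ deg G v + b ⊙ℕ ends x y v
  deg-setEdge b v = begin
    deg G′ v + adj G x y ⊙ℕ ends x y v
      ≡⟨ cong₂ (λ d e → d + adj G x y ⊙ℕ e) (deg≡∑ G′ v) ends≡ ⟩
    ∑ (λ j → 𝟙 (adj G′ v j)) + adj G x y ⊙ℕ ∑ (λ j → 𝟙 (does (samePair? x y v j)))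
      ≡⟨ ℕ-Sums.∑-update (λ j → does (samePair? x y v j)) (adj G v) (adj G x y) b (λ _ → 1)
           (λ j → adj-samePair) ⟩
    ∑ (λ j → 𝟙 (adj G v j)) + b ⊙ℕ ∑ (λ j → 𝟙 (does (samePair? x y v j)))
      ≡⟨ cong₂ (λ d e → d + b ⊙ℕ e) (deg≡∑ G v) ends≡ ⟨
    deg G v + b ⊙ℕ ends x y v ∎
    where
    open ≡-Reasoning
    G′ = setEdge x y x≢y b G
    ends≡ : ends x y v ≡ ∑ (λ j → 𝟙 (does (samePair? x y v j)))
    ends≡ = sym (ℕ-Sums.∑-pair (does (v ≟ x)) (does (v ≟ y)) x y (λ _ → 1)
      λ (v≡x , v≡y) → x≢y (trans (sym (T-does (v ≟ x) v≡x)) (T-does (v ≟ y) v≡y)))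

  deg-removeEdge : adj G x y ≡ true → ∀ v → deg (setEdge x y x≢y false G) v + ends x y v ≡ deg G v
  deg-removeEdge x∼y v = begin
    deg G′ v + ends x y v                ≡⟨ cong (λ β → deg G′ v + β ⊙ℕ ends x y v) x∼y ⟨
    deg G′ v + adj G x y ⊙ℕ ends x y v   ≡⟨ deg-setEdge false v ⟩
    deg G v + 0                          ≡⟨ +-identityʳ _ ⟩
    deg G v                              ∎
    where
    open ≡-Reasoning
    G′ = setEdge x y x≢y false G

  deg-addEdge : adj G x y ≡ false → ∀ v → deg (setEdge x y x≢y true G) v ≡ deg G v + ends x y v
  deg-addEdge x≁y v = begin
    deg G′ v                             ≡⟨ +-identityʳ _ ⟨
    deg G′ v + 0                         ≡⟨ cong (λ β → deg G′ v + β ⊙ℕ ends x y v) x≁y ⟨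
    deg G′ v + adj G x y ⊙ℕ ends x y v   ≡⟨ deg-setEdge true v ⟩
    deg G v + ends x y v                 ∎
    where
    open ≡-Reasoning
    G′ = setEdge x y x≢y true G

module EdgeSum (A : OrderedAbGroup) where

  open OrderedAbGroup A

  ⊕-isCommutativeMonoid : IsCommutativeMonoid _≡_ _⊕_ 𝟘
  ⊕-isCommutativeMonoid = isCommutativeMonoidˡ record
    { isSemigroup = record
      { isMagma = record { isEquivalence = isEquivalence ; ∙-cong = cong₂ _⊕_ }
      ; assoc   = ⊕-assoc
      }
    ; identityˡ = ⊕-idˡ
    ; comm      = ⊕-comm
    }

  open GuardedSums ⊕-isCommutativeMonoid public
    using (_⊙_; ⊙-∧; ∑-⊙; ∑-δ; ∑-pair; ∑-update; ∑-distrib-+; sum-cong-≗; listSum-concatMap; listSum-if)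
    renaming (sum to ∑ᴬ)

  ⊕-idʳ : ∀ x → x ⊕ 𝟘 ≡ x
  ⊕-idʳ x = trans (⊕-comm x 𝟘) (⊕-idˡ x)

  edgeSum : ∀ {n} → Graph n → (Fin n → Fin n → Carrier) → Carrier
  edgeSum G W = ∑ᴬ λ i → ∑ᴬ λ j → adj G i j ⊙ (toℕ i <ᵇ toℕ j) ⊙ W i j

  M≡edgeSum : ∀ {n} (f : ℕ → ℕ → Carrier) (G : Graph n) →
    M A f G ≡ edgeSum G (λ i j → f (deg G i) (deg G j))
  M≡edgeSum {n} f G = trans (listSum-concatMap {n = n} w row id)
    (sum-cong-≗ λ i → trans (listSum-concatMap {n = n} w (entry i) id)
      (sum-cong-≗ λ j → trans (listSum-if w (adj G i j ∧ (toℕ i <ᵇ toℕ j)) (i , j)) (⊙-∧ (adj G i j) _ _)))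
    where
    w : Fin n × Fin n → Carrier
    w (i , j) = f (deg G i) (deg G j)
    entry : Fin n → Fin n → List (Fin n × Fin n)
    entry i j = if adj G i j ∧ (toℕ i <ᵇ toℕ j) then (i , j) ∷ [] else []
    row : Fin n → List (Fin n × Fin n)
    row i = concatMap (entry i) (allFin n)

  counted-once : ∀ {n} {x y : Fin n} → x ≢ y → (W : Fin n → Fin n → Carrier) → W x y ≡ W y x →
    ((toℕ x <ᵇ toℕ y) ⊙ W x y) ⊕ ((toℕ y <ᵇ toℕ x) ⊙ W y x) ≡ W x y
  counted-once {x = x} {y} x≢y W Wxy≡Wyx with toℕ x <ᵇ toℕ y in x<y | toℕ y <ᵇ toℕ x in y<x
  ... | true  | true  = ⊥-elim (<-asym (<ᵇ-true {toℕ x} x<y) (<ᵇ-true {toℕ y} y<x))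
  ... | true  | false = ⊕-idʳ (W x y)
  ... | false | true  = trans (⊕-idˡ (W y x)) (sym Wxy≡Wyx)
  ... | false | false =
    ⊥-elim (x≢y (toℕ-injective (≤-antisym (≮⇒≥ (<ᵇ-false {toℕ y} y<x))
                                           (≮⇒≥ (<ᵇ-false {toℕ x} x<y)))))

  module _ {n} (G : Graph n) {x y : Fin n} (x≢y : x ≢ y)
           (W : Fin n → Fin n → Carrier) (W-sym : ∀ i j → W i j ≡ W j i) where

    private
      w : Fin n → Fin n → Carrier
      w i j = (toℕ i <ᵇ toℕ j) ⊙ W i j

      c : Fin n → Fin n → Bool
      c i j = does (samePair? x y i j)

      Q : Fin n → Carrier
      Q i = ∑ᴬ λ j → c i j ⊙ w i j

      ∑Q≡W : ∑ᴬ Q ≡ W x y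
      ∑Q≡W = begin
        ∑ᴬ Q
          ≡⟨ sum-cong-≗ (λ i → ∑-pair (does (i ≟ x)) (does (i ≟ y)) x y (w i) (exclusive i)) ⟩
        ∑ᴬ (λ i → (does (i ≟ x) ⊙ w i y) ⊕ (does (i ≟ y) ⊙ w i x))
          ≡⟨ ∑-distrib-+ {n} _ _ ⟩
        ∑ᴬ (λ i → does (i ≟ x) ⊙ w i y) ⊕ ∑ᴬ (λ i → does (i ≟ y) ⊙ w i x)
          ≡⟨ cong₂ _⊕_ (∑-δ x (λ i → w i y)) (∑-δ y (λ i → w i x)) ⟩
        w x y ⊕ w y x
          ≡⟨ counted-once x≢y W (W-sym x y) ⟩
        W x y ∎
        where
        open ≡-Reasoning
        exclusive : ∀ i → ¬ (T (does (i ≟ x)) × T (does (i ≟ y)))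
        exclusive i (i≡x , i≡y) = x≢y (trans (sym (T-does (i ≟ x) i≡x)) (T-does (i ≟ y) i≡y))

    edgeSum-setEdge : ∀ b → edgeSum (setEdge x y x≢y b G) W ⊕ adj G x y ⊙ W x y ≡ edgeSum G W ⊕ b ⊙ W x y
    edgeSum-setEdge b = begin
      edgeSum G′ W ⊕ β ⊙ W x y
        ≡⟨ cong (λ q → edgeSum G′ W ⊕ β ⊙ q) ∑Q≡W ⟨
      edgeSum G′ W ⊕ β ⊙ ∑ᴬ Q
        ≡⟨ cong (edgeSum G′ W ⊕_) (∑-⊙ {n} β Q) ⟨
      edgeSum G′ W ⊕ ∑ᴬ (λ i → β ⊙ Q i)
        ≡⟨ ∑-distrib-+ {n} _ _ ⟨
      ∑ᴬ (λ i → row G′ i ⊕ β ⊙ Q i)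
        ≡⟨ sum-cong-≗ (λ i → ∑-update (c i) (adj G i) β b (w i) (λ j → adj-samePair G x≢y)) ⟩
      ∑ᴬ (λ i → row G i ⊕ b ⊙ Q i)
        ≡⟨ ∑-distrib-+ {n} _ _ ⟩
      edgeSum G W ⊕ ∑ᴬ (λ i → b ⊙ Q i)
        ≡⟨ cong (edgeSum G W ⊕_) (∑-⊙ {n} b Q) ⟩
      edgeSum G W ⊕ b ⊙ ∑ᴬ Q
        ≡⟨ cong (λ q → edgeSum G W ⊕ b ⊙ q) ∑Q≡W ⟩
      edgeSum G W ⊕ b ⊙ W x y ∎
      where
      open ≡-Reasoning
      G′ = setEdge x y x≢y b G
      β = adj G x y
      row : Graph n → Fin n → Carrier
      row H i = ∑ᴬ λ j → adj H i j ⊙ w i j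

    edgeSum-removeEdge : adj G x y ≡ true → edgeSum (setEdge x y x≢y false G) W ⊕ W x y ≡ edgeSum G W
    edgeSum-removeEdge x∼y = begin
      edgeSum G′ W ⊕ W x y                ≡⟨ cong (λ β → edgeSum G′ W ⊕ β ⊙ W x y) x∼y ⟨
      edgeSum G′ W ⊕ adj G x y ⊙ W x y    ≡⟨ edgeSum-setEdge false ⟩
      edgeSum G W ⊕ 𝟘                     ≡⟨ ⊕-idʳ _ ⟩
      edgeSum G W                         ∎
      where
      open ≡-Reasoning
      G′ = setEdge x y x≢y false G

    edgeSum-addEdge : adj G x y ≡ false → edgeSum (setEdge x y x≢y true G) W ≡ edgeSum G W ⊕ W x y
    edgeSum-addEdge x≁y = begin
      edgeSum G′ W                        ≡⟨ ⊕-idʳ _ ⟨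
      edgeSum G′ W ⊕ 𝟘                    ≡⟨ cong (λ β → edgeSum G′ W ⊕ β ⊙ W x y) x≁y ⟨
      edgeSum G′ W ⊕ adj G x y ⊙ W x y    ≡⟨ edgeSum-setEdge true ⟩
      edgeSum G W ⊕ W x y                 ∎
      where
      open ≡-Reasoning
      G′ = setEdge x y x≢y true G

  edgeSum-cong : ∀ {n} (G : Graph n) {V W : Fin n → Fin n → Carrier} → (∀ i j → V i j ≡ W i j) →
    edgeSum G V ≡ edgeSum G W
  edgeSum-cong G V≡W = sum-cong-≗ λ i → sum-cong-≗ λ j → cong (λ w → adj G i j ⊙ _ ⊙ w) (V≡W i j)

record Switchable {n} (G : Graph n) (z a t b : Fin n) : Set where
  field
    z∼a : adj G z a ≡ true
    t∼b : adj G t b ≡ true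
    z≁t : adj G z t ≡ false
    a≁b : adj G a b ≡ false
    z≢t : z ≢ t
    a≢b : a ≢ b

module Switching {n} (G : Graph n) {z a t b : Fin n} (sw : Switchable G z a t b) where

  open Switchable sw

  z≢a : z ≢ a
  z≢a = adj⇒≢ G z∼a

  t≢b : t ≢ b
  t≢b = adj⇒≢ G t∼b

  a≢t : a ≢ t
  a≢t refl with trans (sym z∼a) z≁t
  ... | ()

  b≢z : b ≢ z
  b≢z refl with trans (sym (adj-sym′ G t∼b)) z≁t
  ... | ()

  private
    G₁ G₂ G₃ : Graph n
    G₁ = setEdge z a z≢a false G
    G₂ = setEdge t b t≢b false G₁
    G₃ = setEdge z t z≢t true G₂

  switched : Graph n
  switched = setEdge a b a≢b true G₃

  private
    t∼₁b : adj G₁ t b ≡ true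
    t∼₁b = trans (setEdge-≢ G z≢a false t b
      λ { (inj₁ (t≡z , _)) → z≢t (sym t≡z) ; (inj₂ (t≡a , _)) → a≢t (sym t≡a) }) t∼b

    z≁₂t : adj G₂ z t ≡ false
    z≁₂t = setEdge-keeps G₁ t≢b false z t (setEdge-keeps G z≢a false z t z≁t)

    a≁₃b : adj G₃ a b ≡ false
    a≁₃b = trans (setEdge-≢ G₂ z≢t true a b
      λ { (inj₁ (a≡z , _)) → z≢a (sym a≡z) ; (inj₂ (a≡t , _)) → a≢t a≡t })
      (setEdge-keeps G₁ t≢b false a b (setEdge-keeps G z≢a false a b a≁b))

  switched-z∼t : adj switched z t ≡ true
  switched-z∼t = setEdge-keeps G₃ a≢b true z t (setEdge-≡ G₂ z≢t true)

  switched-a∼b : adj switched a b ≡ true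
  switched-a∼b = setEdge-≡ G₃ a≢b true

  switched-keeps : ∀ i j → adj G i j ≡ true → ¬ SamePair z a i j → ¬ SamePair t b i j →
    adj switched i j ≡ true
  switched-keeps i j i∼j ¬za ¬tb = setEdge-keeps G₃ a≢b true i j (setEdge-keeps G₂ z≢t true i j
    (trans (setEdge-≢ G₁ t≢b false i j ¬tb) (trans (setEdge-≢ G z≢a false i j ¬za) i∼j)))

  switched-keeps-off : ∀ i j → adj G i j ≡ true → i ≢ z → i ≢ t → j ≢ z → j ≢ t →
    adj switched i j ≡ true
  switched-keeps-off i j i∼j i≢z i≢t j≢z j≢t = switched-keeps i j i∼j
    (λ { (inj₁ (i≡z , _)) → i≢z i≡z ; (inj₂ (_ , j≡z)) → j≢z j≡z })
    (λ { (inj₁ (i≡t , _)) → i≢t i≡t ; (inj₂ (_ , j≡t)) → j≢t j≡t })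

  deg-switched : ∀ v → deg switched v ≡ deg G v
  deg-switched v = begin
    deg switched v                        ≡⟨ deg-addEdge G₃ a≢b a≁₃b v ⟩
    deg G₃ v + ends a b v                 ≡⟨ cong (_+ ends a b v) (deg-addEdge G₂ z≢t z≁₂t v) ⟩
    deg G₂ v + ends z t v + ends a b v    ≡⟨ regroup (deg G₂ v) 𝟙[ z ] 𝟙[ t ] 𝟙[ a ] 𝟙[ b ] ⟩
    deg G₂ v + ends t b v + ends z a v    ≡⟨ cong (_+ ends z a v) (deg-removeEdge G₁ t≢b t∼₁b v) ⟩
    deg G₁ v + ends z a v                 ≡⟨ deg-removeEdge G z≢a z∼a v ⟩
    deg G v                               ∎
    where
    open ≡-Reasoning
    𝟙[_] : Fin n → ℕ
    𝟙[ x ] = 𝟙 (does (v ≟ x))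
    regroup : ∀ d z t a b → d + (z + t) + (a + b) ≡ d + (t + b) + (z + a)
    regroup = solve-∀

  switched-connected : Connected G → Walk switched z b ⊎ Walk switched t a → Connected switched
  switched-connected conn bridge u v = lift (conn u v)
    where
    bridges : Walk switched z b ⊎ Walk switched t a → Walk switched z a × Walk switched t b
    bridges (inj₁ z⇝b) = z⇝b ++ʷ step (adj-sym′ switched {a} {b} switched-a∼b) here
                       , step (adj-sym′ switched {z} {t} switched-z∼t) z⇝b
    bridges (inj₂ t⇝a) = step switched-z∼t t⇝a , t⇝a ++ʷ step switched-a∼b here
    z⇝a = proj₁ (bridges bridge)
    t⇝b = proj₂ (bridges bridge)
    edge : ∀ {i j} → adj G i j ≡ true → Walk switched i j
    edge {i} {j} i∼j with samePair? z a i j | samePair? t b i j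
    ... | yes (inj₁ (refl , refl)) | _ = z⇝a
    ... | yes (inj₂ (refl , refl)) | _ = reverseʷ z⇝a
    ... | no _ | yes (inj₁ (refl , refl)) = t⇝b
    ... | no _ | yes (inj₂ (refl , refl)) = reverseʷ t⇝b
    ... | no ¬za | no ¬tb = step (switched-keeps i j i∼j ¬za ¬tb) here
    lift : ∀ {u v} → Walk G u v → Walk switched u v
    lift here        = here
    lift (step e p)  = edge e ++ʷ lift p

  module Value (A : OrderedAbGroup) (f : ℕ → ℕ → OrderedAbGroup.Carrier A) (f-sym : Symmetric A f)
               (deg-pos : ∀ v → 1 ≤ deg G v) where

    open OrderedAbGroup A
    open EdgeSum A

    private
      W : Fin n → Fin n → Carrier
      W i j = f (deg G i) (deg G j)

      W-sym : ∀ i j → W i j ≡ W j i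
      W-sym i j = f-sym (deg G i) (deg G j) (deg-pos i) (deg-pos j)

      M-before : M A f G ≡ edgeSum G₂ W ⊕ (W t b ⊕ W z a)
      M-before = begin
        M A f G                             ≡⟨ M≡edgeSum f G ⟩
        edgeSum G W                         ≡⟨ edgeSum-removeEdge G z≢a W W-sym z∼a ⟨
        edgeSum G₁ W ⊕ W z a                ≡⟨ cong (_⊕ W z a) (edgeSum-removeEdge G₁ t≢b W W-sym t∼₁b) ⟨
        (edgeSum G₂ W ⊕ W t b) ⊕ W z a      ≡⟨ ⊕-assoc _ _ _ ⟩
        edgeSum G₂ W ⊕ (W t b ⊕ W z a)      ∎
        where open ≡-Reasoning

      M-after : M A f switched ≡ edgeSum G₂ W ⊕ (W z t ⊕ W b a)
      M-after = begin
        M A f switched                      ≡⟨ M≡edgeSum f switched ⟩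
        edgeSum switched _                  ≡⟨ edgeSum-cong switched (λ i j →
                                                 cong₂ f (deg-switched i) (deg-switched j)) ⟩
        edgeSum switched W                  ≡⟨ edgeSum-addEdge G₃ a≢b W W-sym a≁₃b ⟩
        edgeSum G₃ W ⊕ W a b                ≡⟨ cong (_⊕ W a b) (edgeSum-addEdge G₂ z≢t W W-sym z≁₂t) ⟩
        (edgeSum G₂ W ⊕ W z t) ⊕ W a b      ≡⟨ ⊕-assoc _ _ _ ⟩
        edgeSum G₂ W ⊕ (W z t ⊕ W a b)      ≡⟨ cong (λ w → edgeSum G₂ W ⊕ (W z t ⊕ w)) (W-sym a b) ⟩
        edgeSum G₂ W ⊕ (W z t ⊕ W b a)      ∎
        where open ≡-Reasoning

      ⊕-monoʳ : ∀ c {x y} → x ≼ y → c ⊕ x ≼ c ⊕ y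
      ⊕-monoʳ c {x} {y} x≼y = subst₂ _≼_ (⊕-comm x c) (⊕-comm y c) (⊕-mono c x≼y)

    module _ (a≤t : deg G a ≤ deg G t) (b≤z : deg G b ≤ deg G z) where

      escalating⇒M≼M-switched : Escalating A f → M A f G ≼ M A f switched
      escalating⇒M≼M-switched (esc , _) = subst₂ _≼_ (sym M-before) (sym M-after)
        (⊕-monoʳ (edgeSum G₂ W) (esc (deg G z) (deg G t) (deg G b) (deg G a) (deg-pos b) (deg-pos a) b≤z a≤t))

      deEscalating⇒M-switched≼M : DeEscalating A f → M A f switched ≼ M A f G
      deEscalating⇒M-switched≼M (desc , _) = subst₂ _≼_ (sym M-after) (sym M-before)
        (⊕-monoʳ (edgeSum G₂ W) (desc (deg G z) (deg G t) (deg G b) (deg G a) (deg-pos b) (deg-pos a) b≤z a≤t))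

module SwitchTowards {n} (G : Graph n) (conn : Connected G) {z t e : Fin n}
  (z≁t : adj G z t ≡ false) (z≢t : z ≢ t) (z∼e : adj G z e ≡ true)
  (z-max : ∀ w → deg G w ≤ deg G z) (t-max : ∀ w → w ≢ z → w ≢ e → deg G w ≤ deg G t) where

  open Distance G z conn

  Result : Set
  Result = ∃₂ λ a b → Σ (Switchable G z a t b) λ sw → let open Switching G sw in
    a ≢ e × (Walk switched z b ⊎ Walk switched t a)

  -- A shortest path z, p, s, …, x, y, t of length m + 2 (s = t when m = 0, s = y when m = 1).
  module Geodesic (m : ℕ) (dist-t : dist t ≡ suc (suc m)) where

    y x s p : Fin n
    y = parent t
    x = parent y
    s = ancestor m t
    p = parent s

    private
      dist-t′ : ∀ i → dist (ancestor i t) ≡ suc (suc m) ∸ i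
      dist-t′ i = trans (dist-ancestor i t) (cong (_∸ i) dist-t)

      below-t : ∀ {k} → k ≤ suc (suc m) → k ≤ dist t
      below-t = subst (_ ≤_) (sym dist-t)

      along : ∀ {i j} → i ≡ j → ancestor i t ≡ ancestor j t
      along = cong (λ i → ancestor i t)

      separated : ∀ {u w} → dist u ≢ dist w → u ≢ w
      separated d≢ u≡w = d≢ (cong dist u≡w)

    y∼t : adj G y t ≡ true
    y∼t = adj-ancestor (below-t (s≤s z≤n))

    x∼y : adj G x y ≡ true
    x∼y = adj-ancestor (below-t (s≤s (s≤s z≤n)))

    p∼s : adj G p s ≡ true
    p∼s = adj-ancestor (below-t (n≤1+n (suc m)))

    z∼p : adj G z p ≡ true
    z∼p = dist≡1⇒adj-root (trans (dist-t′ (suc m)) (m+n∸n≡m 1 (suc m)))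

    x∼z⇒x≡p : adj G z x ≡ true → x ≡ p
    x∼z⇒x≡p z∼x = along (trans (ancestor-adj-root 2 t z∼x) (cong (_∸ 1) dist-t))

    y∼z⇒y≡p : adj G z y ≡ true → y ≡ p
    y∼z⇒y≡p z∼y = along (trans (ancestor-adj-root 1 t z∼y) (cong (_∸ 1) dist-t))

    s∼t⇒s≡y : adj G t s ≡ true → s ≡ y
    s∼t⇒s≡y t∼s = along (ancestor-adj-self (below-t (m≤n+m m 2)) t∼s)

    p∼t⇒p≡y : adj G t p ≡ true → p ≡ y
    p∼t⇒p≡y t∼p = along (ancestor-adj-self (below-t (n≤1+n (suc m))) t∼p)

    y≢z : y ≢ z
    y≢z = separated λ d≡ → 1+n≢0 (trans (sym (dist-t′ 1)) (trans d≡ dist-z))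

    s≢z : s ≢ z
    s≢z = separated λ d≡ → 1+n≢0 (trans (sym (trans (dist-t′ m) (m+n∸n≡m 2 m))) (trans d≡ dist-z))

    x≢t : x ≢ t
    x≢t = separated λ d≡ → <⇒≢ (m≤n⇒m≤1+n ≤-refl) (trans (sym (dist-t′ 2)) (trans d≡ dist-t))

    chain : ∀ {H : Graph n} →
      (∀ i j → adj G i j ≡ true → i ≢ z → i ≢ t → j ≢ z → j ≢ t → adj H i j ≡ true) → Walk H p y
    chain {H} keeps = subst (λ w → Walk H w y) (sym (ancestor-suc m t)) (ancestor-walk m y edge)
      where
      dist-y : dist y ≡ suc m
      dist-y = dist-t′ 1
      inner : ∀ k → k ≤ m → ancestor k y ≢ z × ancestor k y ≢ t
      inner k k≤m =
          separated (λ d≡ → <⇒≢ (m<n⇒0<n∸m (s≤s k≤m)) (sym (trans (sym dist-k) (trans d≡ dist-z))))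
        , separated (λ d≡ → <⇒≢ (s≤s (m∸n≤m (suc m) k)) (trans (sym dist-k) (trans d≡ dist-t)))
        where
        dist-k : dist (ancestor k y) ≡ suc m ∸ k
        dist-k = trans (dist-ancestor k y) (cong (_∸ k) dist-y)
      edge : ∀ i → i < m → adj H (ancestor (suc i) y) (ancestor i y) ≡ true
      edge i i<m with inner (suc i) i<m | inner i (<⇒≤ i<m)
      ... | ≢z′ , ≢t′ | ≢z , ≢t =
        keeps _ _ (adj-ancestor (subst (i <_) (sym dist-y) (m≤n⇒m≤1+n i<m))) ≢z′ ≢t′ ≢z ≢t

    switch-if-e≡p : e ≡ p → Result
    switch-if-e≡p e≡p
      with any? (λ a → (adj G z a Bool.≟ true) ×-dec ¬? (a ≟ p) ×-dec (adj G a y Bool.≟ false))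
    ... | yes (a , z∼a , a≢p , a≁y) =
      a , y , sw , (λ a≡e → a≢p (trans a≡e e≡p)) , inj₁ (step z∼p′ (chain switched-keeps-off))
      where
      a≢y : a ≢ y
      a≢y a≡y = a≢p (trans a≡y (y∼z⇒y≡p (subst (λ w → adj G z w ≡ true) a≡y z∼a)))
      sw : Switchable G z a t y
      sw = record
        { z∼a = z∼a ; t∼b = adj-sym′ G y∼t ; z≁t = z≁t ; a≁b = a≁y ; z≢t = z≢t ; a≢b = a≢y }
      open Switching G sw
      z∼p′ : adj switched z p ≡ true
      z∼p′ = switched-keeps z p z∼p
        (λ { (inj₁ (_ , p≡a)) → a≢p (sym p≡a) ; (inj₂ (z≡a , _)) → adj⇒≢ G z∼a z≡a })
        (λ { (inj₁ (z≡t , _)) → z≢t z≡t ; (inj₂ (z≡y , _)) → y≢z (sym z≡y) })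
    ... | no none = ⊥-elim (<⇒≱ y-beats-z (z-max y))
      where
      covers : ∀ j → adj G z j ≡ true → j ≢ p → adj G y j ≡ true
      covers j z∼j j≢p with adj G j y in j∼y
      ... | true  = trans (adj-sym G y j) j∼y
      ... | false = ⊥-elim (none (j , z∼j , j≢p , j∼y))
      y-beats-z : deg G z < deg G y
      y-beats-z = deg-<-by-cover G z∼p covers y∼t (adj-sym′ G x∼y)
        (λ z∼t → ⊥-elim (true≢false (trans (sym z∼t) z≁t))) x∼z⇒x≡p (≢-sym x≢t)

    switch-if-e≢p : e ≢ p → Result
    switch-if-e≢p e≢p
      with any? (λ b → (adj G t b Bool.≟ true) ×-dec ¬? (b ≟ y) ×-dec (adj G p b Bool.≟ false))
    ... | yes (b , t∼b , b≢y , p≁b) =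
      p , b , sw , ≢-sym e≢p , inj₂ (step t∼y′ (reverseʷ (chain switched-keeps-off)))
      where
      p≢b : p ≢ b
      p≢b p≡b = b≢y (trans (sym p≡b) (p∼t⇒p≡y (subst (λ w → adj G t w ≡ true) (sym p≡b) t∼b)))
      sw : Switchable G z p t b
      sw = record { z∼a = z∼p ; t∼b = t∼b ; z≁t = z≁t ; a≁b = p≁b ; z≢t = z≢t ; a≢b = p≢b }
      open Switching G sw
      t∼y′ : adj switched t y ≡ true
      t∼y′ = switched-keeps t y (adj-sym′ G y∼t)
        (λ { (inj₁ (t≡z , _)) → z≢t (sym t≡z) ; (inj₂ (_ , y≡z)) → y≢z y≡z })
        (λ { (inj₁ (_ , y≡b)) → b≢y (sym y≡b) ; (inj₂ (t≡b , _)) → adj⇒≢ G t∼b t≡b })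
    ... | no none = ⊥-elim (<⇒≱ p-beats-t (t-max p (≢-sym (adj⇒≢ G z∼p)) (≢-sym e≢p)))
      where
      covers : ∀ j → adj G t j ≡ true → j ≢ y → adj G p j ≡ true
      covers j t∼j j≢y with adj G p j in p∼j
      ... | true  = refl
      ... | false = ⊥-elim (none (j , t∼j , j≢y , p∼j))
      p-beats-t : deg G t < deg G p
      p-beats-t = deg-<-by-cover G (adj-sym′ G y∼t) covers (adj-sym′ G z∼p) p∼s
        (λ t∼z → ⊥-elim (true≢false (trans (sym (adj-sym′ G t∼z)) z≁t))) s∼t⇒s≡y (≢-sym s≢z)

  switchTowards : Result
  switchTowards with dist t in dist-t
  ... | zero        = ⊥-elim (z≢t (sym (dist≡0 dist-t)))
  ... | suc zero    = ⊥-elim (true≢false (trans (sym (dist≡1⇒adj-root dist-t)) z≁t))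
  ... | suc (suc m) with e ≟ Geodesic.p m dist-t
  ...   | yes e≡p = Geodesic.switch-if-e≡p m dist-t e≡p
  ...   | no  e≢p = Geodesic.switch-if-e≢p m dist-t e≢p

functions : ∀ {X : Set} → List X → ∀ m → List (Fin m → X)
functions xs zero    = (λ ()) ∷ []
functions xs (suc m) = concatMap (λ x → map (x ∷ᶠ_) (functions xs m)) xs

functions-complete : ∀ {X : Set} (_∼_ : X → X → Set) {xs : List X} → (∀ x → Any (_∼ x) xs) →
  ∀ m (h : Fin m → X) → Any (λ g → ∀ i → g i ∼ h i) (functions xs m)
functions-complete _∼_ complete zero    h = here (λ ())
functions-complete _∼_ {xs} complete (suc m) h =
  concatMap⁺ (λ x → map (x ∷ᶠ_) (functions xs m)) (Any.map (λ x∼h₀ → map⁺ (Any.map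
    (λ g∼h → λ { zero → x∼h₀ ; (suc i) → g∼h i })
    (functions-complete _∼_ complete m (λ i → h (suc i)))))
  (complete (h zero)))

SameAdj : ∀ {n} → Graph n → Graph n → Set
SameAdj {n} G H = ∀ (i j : Fin n) → adj G i j ≡ adj H i j

module _ {n} (g : Fin n → Fin n → Bool) where

  private
    upper : Fin n → Fin n → Bool
    upper i j with Finₚ.<-cmp i j
    ... | tri< _ _ _ = g i j
    ... | tri≈ _ _ _ = false
    ... | tri> _ _ _ = g j i

    upper-sym : ∀ i j → upper i j ≡ upper j i
    upper-sym i j with Finₚ.<-cmp i j | Finₚ.<-cmp j i
    ... | tri< _ _ _   | tri> _ _ _   = refl
    ... | tri≈ _ _ _   | tri≈ _ _ _   = refl
    ... | tri> _ _ _   | tri< _ _ _   = refl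
    ... | tri< i<j _ _ | tri< j<i _ _ = ⊥-elim (Finₚ.<-asym i<j j<i)
    ... | tri< _ i≢j _ | tri≈ _ j≡i _ = ⊥-elim (i≢j (sym j≡i))
    ... | tri≈ _ i≡j _ | tri< _ j≢i _ = ⊥-elim (j≢i (sym i≡j))
    ... | tri≈ _ i≡j _ | tri> _ j≢i _ = ⊥-elim (j≢i (sym i≡j))
    ... | tri> _ i≢j _ | tri≈ _ j≡i _ = ⊥-elim (i≢j (sym j≡i))
    ... | tri> _ _ j<i | tri> _ _ i<j = ⊥-elim (Finₚ.<-asym i<j j<i)

    upper-irr : ∀ i → upper i i ≡ false
    upper-irr i with Finₚ.<-cmp i i
    ... | tri< i<i _ _ = ⊥-elim (Finₚ.<-irrefl refl i<i)
    ... | tri≈ _ _ _   = refl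
    ... | tri> _ _ i<i = ⊥-elim (Finₚ.<-irrefl refl i<i)

  fromUpper : Graph n
  fromUpper = record { adj = upper ; adj-sym = upper-sym ; adj-irr = upper-irr }

  fromUpper-adj : (H : Graph n) → (∀ i j → g i j ≡ adj H i j) → SameAdj fromUpper H
  fromUpper-adj H g≗H i j with Finₚ.<-cmp i j
  ... | tri< _ _ _    = g≗H i j
  ... | tri≈ _ refl _ = sym (adj-irr H i)
  ... | tri> _ _ _    = trans (g≗H j i) (adj-sym H j i)

abstract

  graphs : ∀ n → List (Graph n)
  graphs n = map fromUpper (functions (functions (true ∷ false ∷ []) n) n)

  graphs-complete : ∀ {n} (H : Graph n) → Any (λ G → SameAdj G H) (graphs n)
  graphs-complete {n} H = map⁺ (Any.map (λ {g} g≗H → fromUpper-adj g H g≗H)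
    (functions-complete (λ r r′ → ∀ j → r j ≡ r′ j) (functions-complete _≡_ bool-complete n) n (adj H)))
    where
    bool-complete : ∀ b → Any (_≡ b) (true ∷ false ∷ [])
    bool-complete true  = here refl
    bool-complete false = Any.there (here refl)

insert-cong : ∀ {m} (i j : Fin (suc m)) {π ρ : Permutation′ m} → π ≈ ρ → insert i j π ≈ insert i j ρ
insert-cong i j π≈ρ k with i ≟ k
... | yes _ = refl
... | no  _ = cong (punchIn j) (π≈ρ _)

abstract

  permutations : ∀ m → List (Permutation′ m)
  permutations zero    = Perm.id ∷ []
  permutations (suc m) = concatMap (λ j → map (insert zero j) (permutations m)) (allFin (suc m))

  permutations-complete : ∀ m (π : Permutation′ m) → Any (_≈ π) (permutations m)
  permutations-complete zero    π = here (λ ())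
  permutations-complete (suc m) π =
    concatMap⁺ (λ j → map (insert zero j) (permutations m)) (tabulate⁺ {f = id} (π ⟨$⟩ʳ zero) (map⁺ (Any.map
      (λ ρ≈ k → trans (insert-cong zero (π ⟨$⟩ʳ zero) ρ≈ k) (insert-remove zero π k))
      (permutations-complete m (remove zero π)))))

module _ {n} {G H : Graph n} (G≗H : SameAdj G H) where

  deg-cong : ∀ v → deg G v ≡ deg H v
  deg-cong v = trans (deg≡∑ G v) (trans (∑-cong (λ j → cong 𝟙 (G≗H v j))) (sym (deg≡∑ H v)))

  connected-cong : Connected G → Connected H
  connected-cong conn u v = transport (conn u v)
    where
    transport : ∀ {u v} → Walk G u v → Walk H u v
    transport here         = here
    transport (step uw p)  = step (trans (sym (G≗H _ _)) uw) (transport p)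

  M-cong : (A : OrderedAbGroup) (f : ℕ → ℕ → OrderedAbGroup.Carrier A) → M A f G ≡ M A f H
  M-cong A f = trans (M≡edgeSum f G) (trans (sum-cong-≗ λ i → sum-cong-≗ λ j →
      cong₂ (λ b w → b ⊙ _ ⊙ w) (G≗H i j) (cong₂ f (deg-cong i) (deg-cong j)))
    (sym (M≡edgeSum f H)))
    where open EdgeSum A

Labelled : ∀ {n} → (Fin n → ℕ) → Graph n → Permutation′ n → Set
Labelled d G σ = ∀ i → deg G (σ ⟨$⟩ʳ i) ≡ d i

module Candidates {n} (d : Fin n → ℕ) where

  Candidate : Graph n → Set
  Candidate G = Connected G × Any (Labelled d G) (permutations n)

  candidate? : Decidable Candidate
  candidate? G = connected? G ×-dec Any.any? (λ σ → all? λ i → deg G (σ ⟨$⟩ʳ i) ℕ.≟ d i) (permutations n)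

  candidate⇒InΓ : ∀ {G} → Candidate G → InΓ d G
  candidate⇒InΓ (conn , labelled) = conn , Any.satisfied labelled

  InΓ⇒candidate : ∀ {G H} → SameAdj G H → InΓ d H → Candidate G
  InΓ⇒candidate {G} {H} G≗H (conn , σ , labelled) =
    connected-cong {G = H} (λ i j → sym (G≗H i j)) conn ,
    Any.map (λ ρ≈σ i → trans (cong (deg G) (ρ≈σ i)) (trans (deg-cong {G = G} {H = H} G≗H (σ ⟨$⟩ʳ i))
                                                            (labelled i)))
      (permutations-complete n σ)

module Optimality (A : OrderedAbGroup) (f : ℕ → ℕ → OrderedAbGroup.Carrier A) where

  open OrderedAbGroup A

  Worse : Escalating A f ⊎ DeEscalating A f → Carrier → Carrier → Set
  Worse (inj₁ _) x y = x ≼ y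
  Worse (inj₂ _) x y = y ≼ x

  worse-isTotalOrder : ∀ o → IsTotalOrder _≡_ (Worse o)
  worse-isTotalOrder (inj₁ _) = record
    { isPartialOrder = record
      { isPreorder = record
        { isEquivalence = isEquivalence ; reflexive = λ { refl → ≼-refl _ } ; trans = ≼-trans }
      ; antisym    = ≼-antisym
      }
    ; total = ≼-total
    }
  worse-isTotalOrder (inj₂ _) = record
    { isPartialOrder = record
      { isPreorder = record
        { isEquivalence = isEquivalence ; reflexive = λ { refl → ≼-refl _ } ; trans = flip ≼-trans }
      ; antisym    = flip ≼-antisym
      }
    ; total = flip ≼-total
    }

  worse-trans : ∀ o {x y z} → Worse o x y → Worse o y z → Worse o x z
  worse-trans o = IsTotalOrder.trans (worse-isTotalOrder o)

  order : Escalating A f ⊎ DeEscalating A f → TotalOrder 0ℓ 0ℓ 0ℓ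
  order o = record { isTotalOrder = worse-isTotalOrder o }

  Optimal : Escalating A f ⊎ DeEscalating A f → ∀ {n} → (Fin n → ℕ) → Graph n → Set
  Optimal o d G = InΓ d G × (∀ H → InΓ d H → Worse o (M A f H) (M A f G))

  optimal-exists : ∀ o {n} (d : Fin n → ℕ) {G₀} → InΓ d G₀ → ∃ (Optimal o d)
  optimal-exists o {n} d {G₀} inΓ₀ = best , candidate⇒InΓ best-candidate , beats
    where
    open Extrema (order o)
    open Candidates d
    candidates = filter candidate? (graphs n)
    best = argmax (M A f) G₀ candidates
    best-candidate : Candidate best
    best-candidate = argmax-all (M A f) (InΓ⇒candidate (λ _ _ → refl) inΓ₀) (all-filter candidate? (graphs n))
    beats : ∀ H → InΓ d H → Worse o (M A f H) (M A f best)
    beats H inΓ with find (graphs-complete H)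
    ... | G , G∈graphs , G≗H = subst (λ x → Worse o x (M A f best)) (M-cong {G = G} {H = H} G≗H A f)
      (lookup (f[xs]≤f[argmax] G₀ candidates) (∈-filter⁺ candidate? G∈graphs (InΓ⇒candidate G≗H inΓ)))

  escalating⇒¬deEscalating : Escalating A f → ¬ DeEscalating A f
  escalating⇒¬deEscalating (_ , esc) (_ , desc) = proj₂ below (≼-antisym (proj₁ below) (proj₁ above))
    where
    below = esc 2 2 1 1 ≤-refl ≤-refl ≤-refl ≤-refl
    above = desc 2 2 1 1 ≤-refl ≤-refl ≤-refl ≤-refl

  optimal⇒extremal : ∀ o {n} {d : Fin n → ℕ} {G} → Optimal o d G → Extremal A f d G
  optimal⇒extremal (inj₁ esc)  (inΓ , best) =
    inΓ , (λ _ → best) , (λ desc → ⊥-elim (escalating⇒¬deEscalating esc desc))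
  optimal⇒extremal (inj₂ desc) (inΓ , best) =
    inΓ , (λ esc → ⊥-elim (escalating⇒¬deEscalating esc desc)) , (λ _ → best)

module Labelling {n} {d : Fin n → ℕ} (d-seq : IsSeq d) (G : Graph n) (σ : Permutation′ n)
                 (labelled : Labelled d G σ) where

  deg≡d : ∀ w → deg G w ≡ d (σ ⟨$⟩ˡ w)
  deg≡d w = trans (cong (deg G) (sym (inverseʳ σ))) (labelled (σ ⟨$⟩ˡ w))

  deg-pos : ∀ w → 1 ≤ deg G w
  deg-pos w = subst (1 ≤_) (sym (deg≡d w)) (proj₁ d-seq (σ ⟨$⟩ˡ w))

  deg-≤ : ∀ i w → toℕ i ≤ toℕ (σ ⟨$⟩ˡ w) → deg G w ≤ deg G (σ ⟨$⟩ʳ i)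
  deg-≤ i w i≤w = subst₂ _≤_ (sym (deg≡d w)) (sym (labelled i)) (proj₂ d-seq i (σ ⟨$⟩ˡ w) i≤w)

  deg-≤-unless : ∀ i w → (∀ j → toℕ j < toℕ i → w ≢ σ ⟨$⟩ʳ j) → deg G w ≤ deg G (σ ⟨$⟩ʳ i)
  deg-≤-unless i w avoids = deg-≤ i w (≮⇒≥ λ w<i → avoids (σ ⟨$⟩ˡ w) w<i (sym (inverseʳ σ)))

first-step : ∀ {n} {G : Graph n} {u v} → Walk G u v → u ≢ v → ∃ λ w → adj G u w ≡ true
first-step here         u≢u = ⊥-elim (u≢u refl)
first-step (step u∼w _) _   = _ , u∼w

module Construction (A : OrderedAbGroup) (f : ℕ → ℕ → OrderedAbGroup.Carrier A) (f-sym : Symmetric A f)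
  (o : Escalating A f ⊎ DeEscalating A f) (m : ℕ) (d : Fin (3 + m) → ℕ) (d-seq : IsSeq d)
  (σ : Permutation′ (3 + m)) where

  open Optimality A f

  v₁ v₂ v₃ : Fin (3 + m)
  v₁ = σ ⟨$⟩ʳ zero
  v₂ = σ ⟨$⟩ʳ suc zero
  v₃ = σ ⟨$⟩ʳ suc (suc zero)

  improve : ∀ {G} → Optimal o d G → Labelled d G σ → ∀ {t e} →
    adj G v₁ t ≡ false → v₁ ≢ t → adj G v₁ e ≡ true →
    (∀ w → w ≢ v₁ → w ≢ e → deg G w ≤ deg G t) →
    ∃ λ G′ → Optimal o d G′ × Labelled d G′ σ × adj G′ v₁ t ≡ true × adj G′ v₁ e ≡ true
  improve {G} ((conn , _) , best) labelled {t} {e} v₁≁t v₁≢t v₁∼e t-max =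
    let a , b , sw , a≢e , bridge = SwitchTowards.switchTowards G conn v₁≁t v₁≢t v₁∼e v₁-max t-max
        open Switching G sw
        open Value A f f-sym deg-pos
        labelled′ : Labelled d switched σ
        labelled′ i = trans (deg-switched _) (labelled i)
        a≤t = t-max a (≢-sym z≢a) a≢e
        gain : ∀ o → Worse o (M A f G) (M A f switched)
        gain = λ where
          (inj₁ esc)  → escalating⇒M≼M-switched a≤t (v₁-max b) esc
          (inj₂ desc) → deEscalating⇒M-switched≼M a≤t (v₁-max b) desc
        v₁∼′e = switched-keeps v₁ e v₁∼e
          (λ { (inj₁ (_ , e≡a)) → a≢e (sym e≡a) ; (inj₂ (v₁≡a , _)) → z≢a v₁≡a })
          (λ { (inj₁ (v₁≡t , _)) → v₁≢t v₁≡t ; (inj₂ (v₁≡b , _)) → b≢z (sym v₁≡b) })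
    in switched
       , ((switched-connected conn bridge , σ , labelled′) , λ H inΓ → worse-trans o (best H inΓ) (gain o))
       , labelled′ , switched-z∼t , v₁∼′e
    where
    open Labelling d-seq G σ labelled
    v₁-max : ∀ w → deg G w ≤ deg G v₁
    v₁-max w = deg-≤ zero w z≤n

  private
    σ-injective : ∀ {i j} → σ ⟨$⟩ʳ i ≡ σ ⟨$⟩ʳ j → i ≡ j
    σ-injective {i} {j} σi≡σj = trans (sym (inverseˡ σ)) (trans (cong (σ ⟨$⟩ˡ_) σi≡σj) (inverseˡ σ))

    v₁≢v₂ : v₁ ≢ v₂
    v₁≢v₂ v₁≡v₂ with σ-injective v₁≡v₂
    ... | ()

    v₁≢v₃ : v₁ ≢ v₃
    v₁≢v₃ v₁≡v₃ with σ-injective v₁≡v₃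
    ... | ()

  join-v₂ : ∀ {G} → Optimal o d G → Labelled d G σ →
    ∃ λ G₂ → Optimal o d G₂ × Labelled d G₂ σ × adj G₂ v₁ v₂ ≡ true
  join-v₂ {G} opt labelled = case (adj G v₁ v₂) refl
    where
    open Labelling d-seq G σ labelled
    case : ∀ b → adj G v₁ v₂ ≡ b →
      ∃ λ G₂ → Optimal o d G₂ × Labelled d G₂ σ × adj G₂ v₁ v₂ ≡ true
    case true  v₁∼v₂ = G , opt , labelled , v₁∼v₂
    case false v₁≁v₂ =
      let e , v₁∼e = first-step (proj₁ (proj₁ opt) v₁ v₂) v₁≢v₂
          G₂ , opt₂ , labelled₂ , v₁∼v₂ , _ = improve opt labelled v₁≁v₂ v₁≢v₂ v₁∼e
            (λ w w≢v₁ _ → deg-≤-unless (suc zero) w λ { zero _ → w≢v₁ ; (suc _) (s≤s ()) })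
      in G₂ , opt₂ , labelled₂ , v₁∼v₂

  join-v₃ : ∀ {G} → Optimal o d G → Labelled d G σ → adj G v₁ v₂ ≡ true →
    ∃ λ G₃ → Optimal o d G₃ × Labelled d G₃ σ × adj G₃ v₁ v₂ ≡ true × adj G₃ v₁ v₃ ≡ true
  join-v₃ {G} opt labelled v₁∼v₂ = case (adj G v₁ v₃) refl
    where
    open Labelling d-seq G σ labelled
    case : ∀ b → adj G v₁ v₃ ≡ b →
      ∃ λ G₃ → Optimal o d G₃ × Labelled d G₃ σ × adj G₃ v₁ v₂ ≡ true × adj G₃ v₁ v₃ ≡ true
    case true  v₁∼v₃ = G , opt , labelled , v₁∼v₂ , v₁∼v₃
    case false v₁≁v₃ =
      let G₃ , opt₃ , labelled₃ , v₁∼v₃ , v₁∼v₂′ =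
            improve opt labelled v₁≁v₃ v₁≢v₃ v₁∼v₂ (λ w w≢v₁ w≢v₂ → deg-≤-unless (suc (suc zero)) w
              λ { zero _ → w≢v₁ ; (suc zero) _ → w≢v₂ ; (suc (suc _)) (s≤s (s≤s ())) })
      in G₃ , opt₃ , labelled₃ , v₁∼v₂′ , v₁∼v₃

lemma3 : (A : OrderedAbGroup) (f : ℕ → ℕ → OrderedAbGroup.Carrier A) →
    Symmetric A f → (Escalating A f ⊎ DeEscalating A f) →
    (c m : ℕ) → let n = 3 + m in (d : Fin n → ℕ) → CCyclicDegSeq c d →
    ∃ λ (G : Graph n) → Extremal A f d G ×
      Σ (Permutation′ n) λ σ →
        (∀ i → deg G (σ ⟨$⟩ʳ i) ≡ d i) ×
        (adj G (σ ⟨$⟩ʳ Fin.zero) (σ ⟨$⟩ʳ Fin.suc Fin.zero) ≡ true) ×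
        (adj G (σ ⟨$⟩ʳ Fin.zero) (σ ⟨$⟩ʳ Fin.suc (Fin.suc Fin.zero)) ≡ true)
lemma3 A f f-sym o c m d (d-seq , _ , inΓ₀ , _) =
  let G , opt@(inΓ , _) = optimal-exists o d inΓ₀
      σ , labelled = proj₂ inΓ
      open Construction A f f-sym o m d d-seq σ
      G₂ , opt₂ , labelled₂ , v₁∼v₂ = join-v₂ opt labelled
      G₃ , opt₃ , labelled₃ , v₁∼v₂′ , v₁∼v₃ = join-v₃ opt₂ labelled₂ v₁∼v₂
  in G₃ , optimal⇒extremal o opt₃ , σ , labelled₃ , v₁∼v₂′ , v₁∼v₃
  where open Optimality A f
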